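{- Let $k\ge2$ and $n\ge0$ be integers and $z\in\mathbb{C}$. Then \[ B_{n}^{(k)}(z)=\frac{1}{n+1} \sum_{l=0}^n \binom{n+1}{l+1}B_{n-l}(z+1)\, B_l^{(k-1)}(-1) \] and \[ C_{n}^{(k)}(z) = \frac{1}{n+1}\sum_{l=0}^{n}\binom{n+1}{l+1}B_{n-l}(z)\,C_{l}^{(k-1)}. \]
   Context: $\operatorname{Li}_k(x)=\sum_{m\ge1}x^m/m^k$. Bernoulli polynomials: $\sum_{n\ge0}B_n(z)\frac{t^n}{n!}=\frac{te^{zt}}{e^t-1}$. Poly-Bernoulli polynomials: $\sum_{n\ge0}\frac{B_n^{(k)}(z)}{n!}t^n=\frac{\operatorname{Li}_k(1-e^{ -t})}{1-e^{ -t}}e^{zt}$. Companion polynomials: $\sum_{n\ge0}\frac{C_n^{(k)}(z)}{n!}t^n=\frac{\operatorname{Li}_k(1-e^{ -t})}{e^{t}-1}e^{zt}$, and $C_n^{(k)}=C_n^{(k)}(0)$. -}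

module Defs where

open import Level using (Level)
open import Data.Bool using (if_then_else_)
open import Data.Nat using (ℕ; zero; suc; _∸_; _≤ᵇ_; _!)
  renaming (_^_ to _^ℕ_)
open import Data.Nat.Properties using (_!≢0; m^n≢0)
open import Data.Integer using (+_)
open import Data.Rational using (ℚ; _/_)
open import Algebra.Bundles using (CommutativeRing)

1/! : ℕ → ℚ
1/! n = (+ 1 / (n !)) {{n !≢0}}

1/pow : ℕ → ℕ → ℚ
1/pow j k = (+ 1 / (suc j ^ℕ k)) {{m^n≢0 (suc j) k}}

1/suc : ℕ → ℚ
1/suc n = + 1 / suc n

nat : ℕ → ℚ
nat n = + n / 1

-- Formal power series in t with coefficients in a commutative ring R,
-- where ι : ℚ → R is used to interpret rational constants
-- (in the theorem, ι is required to be a ring homomorphism, i.e. R is a ℚ-algebra).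
module Series {c ℓ : Level} (R : CommutativeRing c ℓ)
              (ι : ℚ → CommutativeRing.Carrier R) where
  open CommutativeRing R

  FPS : Set c
  FPS = ℕ → Carrier

  Σ≤ : ℕ → (ℕ → Carrier) → Carrier
  Σ≤ zero    f = f 0
  Σ≤ (suc n) f = Σ≤ n f + f (suc n)

  pow : Carrier → ℕ → Carrier
  pow a zero    = 1#
  pow a (suc n) = a * pow a n

  oneS : FPS
  oneS zero    = 1#
  oneS (suc _) = 0#

  _⊕_ : FPS → FPS → FPS
  (f ⊕ g) n = f n + g n

  _⊖_ : FPS → FPS → FPS
  (f ⊖ g) n = f n - g n

  _⊛_ : FPS → FPS → FPS
  (f ⊛ g) n = Σ≤ n (λ i → f i * g (n ∸ i))

  _^S_ : FPS → ℕ → FPS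
  f ^S zero  = oneS
  f ^S suc m = f ⊛ (f ^S m)

  expS : Carrier → FPS
  expS a n = pow a n * ι (1/! n)

  -- f / t, for f with zero constant term
  divT : FPS → FPS
  divT f n = f (suc n)

  -- multiplicative inverse of a series whose constant term is 1:
  -- b₀ = 1, b_{n+1} = - Σ_{i=1}^{n+1} a_i b_{n+1-i}
  invUpTo : FPS → ℕ → FPS
  invUpTo a zero    = λ _ → 1#
  invUpTo a (suc n) = λ i → if i ≤ᵇ n then invUpTo a n i
                            else - Σ≤ n (λ j → a (suc j) * invUpTo a n (n ∸ j))

  invS : FPS → FPS
  invS a n = invUpTo a n n

  -- Li_k(f) = Σ_{m≥1} f^m / m^k, for f with zero constant term
  -- (the coefficient of t^n only involves m ≤ n, so truncating at m = n+1 is exact)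
  Li : ℕ → FPS → FPS
  Li k f n = Σ≤ n (λ j → ι (1/pow j k) * (f ^S suc j) n)

  u : FPS
  u = oneS ⊖ expS (- 1#)

  eMinus1 : FPS
  eMinus1 = expS 1# ⊖ oneS

  Bgen : Carrier → FPS
  Bgen z = invS (divT eMinus1) ⊛ expS z

  PBgen : ℕ → Carrier → FPS
  PBgen k z = (divT (Li k u) ⊛ invS (divT u)) ⊛ expS z

  Cgen : ℕ → Carrier → FPS
  Cgen k z = (divT (Li k u) ⊛ invS (divT eMinus1)) ⊛ expS z

  Bpoly : ℕ → Carrier → Carrier
  Bpoly n z = ι (nat (n !)) * Bgen z n

  PB : ℕ → ℕ → Carrier → Carrier
  PB k n z = ι (nat (n !)) * PBgen k z n

  Cpoly : ℕ → ℕ → Carrier → Carrier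
  Cpoly k n z = ι (nat (n !)) * Cgen k z n

  Cnum : ℕ → ℕ → Carrier
  Cnum k n = Cpoly k n 0#

module Submission where

-- Put u = 1 - e^{-t}, L = Li_k(u) and B(z) = t e^{zt}/(e^t - 1).  Since
-- t/u = e^t · t/(e^t - 1), the two generating functions factor as
--     Li_k(u)/u · e^{zt} = (L/t) · B(z+1)   and   Li_k(u)/(e^t - 1) · e^{zt} = (L/t) · B(z),
-- and the chain rule  d/dt Li_k(u) = Li_{k-1}(u)/u · u'  with  u' = e^{-t}  shows
-- that the generating functions of B_l^{(k-1)}(-1) and of C_l^{(k-1)} both equal L'.
-- Comparing n!·[tⁿ] of (L/t)·B, where l!·[t^l](L/t) = l!·[t^l]L' / (l+1) and
-- (n+1)! = C(n+1,l+1)·(l+1)!·(n-l)!, gives both recurrences, for every k ≥ 1.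

open import Defs
open import Level using (Level)
open import Data.Bool using (true; false)
open import Data.Nat as ℕ using (ℕ; zero; suc; _∸_; _≤_; _<_; z≤n; s≤s; _!; _≤ᵇ_)
import Data.Nat.Properties as ℕP
open import Data.Nat.Combinatorics using (_C_; nCk≡n!/k![n-k]!; k![n∸k]!∣n!)
open import Data.Nat.DivMod using (m/n*n≡m)
open import Data.Product using (_×_; _,_)
open import Data.Sum using (inj₁; inj₂)
open import Data.Maybe using (nothing)
open import Data.Rational as ℚ using (ℚ)
open import Data.Rational.Properties using (+-*-commutativeRing)
open import Algebra.Bundles using (CommutativeRing)
open import Algebra.Morphism.Structures using (IsRingHomomorphism)
open import Relation.Binary.Bundles using (Setoid)
open import Relation.Binary.PropositionalEquality as P using (_≡_)
import Relation.Binary.Reasoning.Setoid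

module RationalIdentities where
  open import Data.Integer as ℤ using (+_)
  open import Data.Integer.Properties using (pos-*; pos-+; *-identityʳ)
  open import Data.Rational using (_/_; 1ℚ)
  open import Data.Rational.Properties
    using (fromℚᵘ-cong; toℚᵘ-injective; toℚᵘ-homo-*; toℚᵘ-homo-+; toℚᵘ-fromℚᵘ)
  import Data.Rational.Unnormalised as ℚᵘ
  import Data.Rational.Unnormalised.Properties as ℚᵘP
  open import Data.Nat.Tactic.RingSolver using (solve-∀)

  fraction-≡ : ∀ a b c d → a ℕ.* suc d ≡ c ℕ.* suc b → + a / suc b ≡ + c / suc d
  fraction-≡ a b c d eq = fromℚᵘ-cong {ℚᵘ.mkℚᵘ (+ a) b} {ℚᵘ.mkℚᵘ (+ c) d}
    (ℚᵘ.*≡* (P.trans (P.sym (pos-* a (suc d))) (P.trans (P.cong +_ eq) (pos-* c (suc b)))))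

  fraction-* : ∀ a b c d → (+ a / suc b) ℚ.* (+ c / suc d) ≡ + (a ℕ.* c) / (suc b ℕ.* suc d)
  fraction-* a b c d = toℚᵘ-injective
    (ℚᵘP.≃-trans (toℚᵘ-homo-* (+ a / suc b) (+ c / suc d))
    (ℚᵘP.≃-trans (ℚᵘP.*-cong (toℚᵘ-fromℚᵘ (ℚᵘ.mkℚᵘ (+ a) b)) (toℚᵘ-fromℚᵘ (ℚᵘ.mkℚᵘ (+ c) d)))
    (ℚᵘP.≃-trans (ℚᵘ.*≡* (P.cong (ℤ._* (+ bd)) (P.sym (pos-* a c))))
                 (ℚᵘP.≃-sym (toℚᵘ-fromℚᵘ (ℚᵘ.mkℚᵘ (+ (a ℕ.* c)) (ℕ.pred bd)))))))
    where bd = suc b ℕ.* suc d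

  fraction-*-≡ : ∀ a b c d e f .{{_ : ℕ.NonZero b}} .{{_ : ℕ.NonZero d}} .{{_ : ℕ.NonZero f}} →
    a ℕ.* c ℕ.* f ≡ e ℕ.* (b ℕ.* d) → (+ a / b) ℚ.* (+ c / d) ≡ + e / f
  fraction-*-≡ a (suc b) c (suc d) e (suc f) eq =
    P.trans (fraction-* a b c d) (fraction-≡ (a ℕ.* c) _ e f eq)

  nat-+ : ∀ a b → nat a ℚ.+ nat b ≡ nat (a ℕ.+ b)
  nat-+ a b = toℚᵘ-injective
    (ℚᵘP.≃-trans (toℚᵘ-homo-+ (nat a) (nat b))
    (ℚᵘP.≃-trans (ℚᵘP.+-cong (toℚᵘ-fromℚᵘ (ℚᵘ.mkℚᵘ (+ a) 0)) (toℚᵘ-fromℚᵘ (ℚᵘ.mkℚᵘ (+ b) 0)))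
    (ℚᵘP.≃-trans (ℚᵘ.*≡* (P.cong (ℤ._* + 1) numerators))
                 (ℚᵘP.≃-sym (toℚᵘ-fromℚᵘ (ℚᵘ.mkℚᵘ (+ (a ℕ.+ b)) 0))))))
    where
    numerators : + a ℤ.* + 1 ℤ.+ + b ℤ.* + 1 ≡ + (a ℕ.+ b)
    numerators = P.trans (P.cong₂ ℤ._+_ (*-identityʳ (+ a)) (*-identityʳ (+ b))) (P.sym (pos-+ a b))

  private
    cross₁ : ∀ a b → (a ℕ.* 1) ℕ.* b ≡ 1 ℕ.* (1 ℕ.* (a ℕ.* b))
    cross₁ = solve-∀

    cross₂ : ∀ n → 1 ℕ.* n ℕ.* 1 ≡ 1 ℕ.* (n ℕ.* 1)
    cross₂ = solve-∀

  nat-*-1/! : ∀ n → nat (suc n) ℚ.* 1/! (suc n) ≡ 1/! n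
  nat-*-1/! n = fraction-*-≡ (suc n) 1 1 (suc n !) 1 (n !) {{_}} {{suc n ℕP.!≢0}} {{n ℕP.!≢0}}
    (cross₁ (suc n) (n !))

  1/suc-*-nat : ∀ n → 1/suc n ℚ.* nat (suc n) ≡ 1ℚ
  1/suc-*-nat n = fraction-*-≡ 1 (suc n) (suc n) 1 1 1 (cross₂ (suc n))

  nat-*-1/pow : ∀ j k → nat (suc j) ℚ.* 1/pow j (suc k) ≡ 1/pow j k
  nat-*-1/pow j k = fraction-*-≡ (suc j) 1 1 (suc j ℕ.^ suc k) 1 (suc j ℕ.^ k)
    {{_}} {{ℕP.m^n≢0 (suc j) (suc k)}} {{ℕP.m^n≢0 (suc j) k}} (cross₁ (suc j) (suc j ℕ.^ k))

module PowerSeries {c ℓ : Level} (R : CommutativeRing c ℓ) (ι : ℚ → CommutativeRing.Carrier R)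
  (hom : IsRingHomomorphism (CommutativeRing.rawRing +-*-commutativeRing) (CommutativeRing.rawRing R) ι) where

  open CommutativeRing R hiding (zero)
  open Series R ι
  open RationalIdentities
  open IsRingHomomorphism hom using (+-homo; *-homo; 0#-homo; 1#-homo)
  open import Relation.Binary.Reasoning.Setoid setoid
  open import Algebra.Properties.Ring ring using (x[y-z]≈xy-xz; -‿distribʳ-*; -‿+-comm)
  open import Algebra.Properties.Semiring.Mult semiring using (×-homo-+; ×1-homo-*) renaming (_×_ to _·_)
  open import Algebra.Properties.CommutativeSemigroup +-commutativeSemigroup using (interchange)
  open import Algebra.Properties.CommutativeSemigroup *-commutativeSemigroup using (x∙yz≈y∙xz)
  open import Algebra.Solver.Ring.NaturalCoefficients commutativeSemiring (λ _ _ → nothing)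

  -- Finite sums Σ_{i ≤ n}

  Σ-cong≤ : ∀ n {f g : ℕ → Carrier} → (∀ i → i ≤ n → f i ≈ g i) → Σ≤ n f ≈ Σ≤ n g
  Σ-cong≤ zero    e = e 0 z≤n
  Σ-cong≤ (suc n) e = +-cong (Σ-cong≤ n (λ i p → e i (ℕP.m≤n⇒m≤1+n p))) (e (suc n) ℕP.≤-refl)

  Σ-cong : ∀ n {f g : ℕ → Carrier} → (∀ i → f i ≈ g i) → Σ≤ n f ≈ Σ≤ n g
  Σ-cong n e = Σ-cong≤ n (λ i _ → e i)

  Σ-zero : ∀ n (f : ℕ → Carrier) → (∀ i → i ≤ n → f i ≈ 0#) → Σ≤ n f ≈ 0#
  Σ-zero n f e = trans (Σ-cong≤ n e) (zeros n)
    where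
    zeros : ∀ m → Σ≤ m (λ _ → 0#) ≈ 0#
    zeros zero    = refl
    zeros (suc m) = trans (+-identityʳ _) (zeros m)

  Σ-+ : ∀ n (f g : ℕ → Carrier) → Σ≤ n (λ i → f i + g i) ≈ Σ≤ n f + Σ≤ n g
  Σ-+ zero    f g = refl
  Σ-+ (suc n) f g = trans (+-cong (Σ-+ n f g) refl) (interchange _ _ _ _)

  Σ-*ˡ : ∀ n a (f : ℕ → Carrier) → a * Σ≤ n f ≈ Σ≤ n (λ i → a * f i)
  Σ-*ˡ zero    a f = refl
  Σ-*ˡ (suc n) a f = trans (distribˡ a _ _) (+-cong (Σ-*ˡ n a f) refl)

  Σ-*ʳ : ∀ n a (f : ℕ → Carrier) → Σ≤ n f * a ≈ Σ≤ n (λ i → f i * a)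
  Σ-*ʳ zero    a f = refl
  Σ-*ʳ (suc n) a f = trans (distribʳ a _ _) (+-cong (Σ-*ʳ n a f) refl)

  Σ-neg : ∀ n (f : ℕ → Carrier) → - Σ≤ n f ≈ Σ≤ n (λ i → - f i)
  Σ-neg zero    f = refl
  Σ-neg (suc n) f = trans (sym (-‿+-comm _ _)) (+-cong (Σ-neg n f) refl)

  Σ-unfoldˡ : ∀ n (f : ℕ → Carrier) → Σ≤ (suc n) f ≈ f 0 + Σ≤ n (λ i → f (suc i))
  Σ-unfoldˡ zero    f = refl
  Σ-unfoldˡ (suc n) f = trans (+-cong (Σ-unfoldˡ n f) refl) (+-assoc _ _ _)

  Σ-reverse : ∀ n (f : ℕ → Carrier) → Σ≤ n f ≈ Σ≤ n (λ i → f (n ∸ i))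
  Σ-reverse zero    f = refl
  Σ-reverse (suc n) f = begin
    Σ≤ n f + f (suc n)                   ≈⟨ +-cong (Σ-reverse n f) refl ⟩
    Σ≤ n (λ i → f (n ∸ i)) + f (suc n)   ≈⟨ +-comm _ _ ⟩
    f (suc n) + Σ≤ n (λ i → f (n ∸ i))   ≈⟨ Σ-unfoldˡ n (λ i → f (suc n ∸ i)) ⟨
    Σ≤ (suc n) (λ i → f (suc n ∸ i))     ∎

  Σ-triangle : ∀ n (F : ℕ → ℕ → Carrier) →
    Σ≤ n (λ i → Σ≤ i (λ j → F j (i ∸ j))) ≈ Σ≤ n (λ j → Σ≤ (n ∸ j) (F j))
  Σ-triangle zero    F = refl
  Σ-triangle (suc n) F = begin
    Σ≤ n (λ i → Σ≤ i (λ j → F j (i ∸ j))) + (Σ≤ n (λ j → F j (suc n ∸ j)) + F (suc n) (n ∸ n))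
      ≈⟨ +-cong (Σ-triangle n F) refl ⟩
    Σ≤ n (λ j → Σ≤ (n ∸ j) (F j)) + (Σ≤ n (λ j → F j (suc n ∸ j)) + F (suc n) (n ∸ n))
      ≈⟨ +-assoc _ _ _ ⟨
    (Σ≤ n (λ j → Σ≤ (n ∸ j) (F j)) + Σ≤ n (λ j → F j (suc n ∸ j))) + F (suc n) (n ∸ n)
      ≈⟨ +-cong (Σ-+ n _ _) refl ⟨
    Σ≤ n (λ j → Σ≤ (n ∸ j) (F j) + F j (suc n ∸ j)) + F (suc n) (n ∸ n)
      ≈⟨ +-cong (Σ-cong≤ n (λ j → extend-row j)) (last-row (F (suc n))) ⟩
    Σ≤ n (λ j → Σ≤ (suc n ∸ j) (F j)) + Σ≤ (n ∸ n) (F (suc n)) ∎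
    where
    extend-row : ∀ j → j ≤ n → Σ≤ (n ∸ j) (F j) + F j (suc n ∸ j) ≈ Σ≤ (suc n ∸ j) (F j)
    extend-row j j≤n rewrite ℕP.+-∸-assoc 1 j≤n = refl
    last-row : ∀ (G : ℕ → Carrier) → G (n ∸ n) ≈ Σ≤ (n ∸ n) G
    last-row G rewrite ℕP.n∸n≡0 n = refl

  Σ-dropZeros : ∀ j n (f : ℕ → Carrier) → j ≤ n → (∀ i → i < j → f i ≈ 0#) →
    Σ≤ n f ≈ Σ≤ (n ∸ j) (λ l → f (j ℕ.+ l))
  Σ-dropZeros zero    n       f _         _ = refl
  Σ-dropZeros (suc j) (suc n) f (s≤s j≤n) z = begin
    Σ≤ (suc n) f                  ≈⟨ Σ-unfoldˡ n f ⟩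
    f 0 + Σ≤ n (λ i → f (suc i))  ≈⟨ +-cong (z 0 (s≤s z≤n)) refl ⟩
    0# + Σ≤ n (λ i → f (suc i))   ≈⟨ +-identityˡ _ ⟩
    Σ≤ n (λ i → f (suc i))        ≈⟨ Σ-dropZeros j n (λ i → f (suc i)) j≤n (λ i p → z (suc i) (s≤s p)) ⟩
    Σ≤ (n ∸ j) (λ l → f (suc (j ℕ.+ l))) ∎

  infix 4 _≋_
  _≋_ : FPS → FPS → Set ℓ
  f ≋ g = ∀ n → f n ≈ g n

  ≋-refl : ∀ {f} → f ≋ f
  ≋-refl n = refl

  ≋-sym : ∀ {f g} → f ≋ g → g ≋ f
  ≋-sym e n = sym (e n)

  ≋-trans : ∀ {f g h} → f ≋ g → g ≋ h → f ≋ h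
  ≋-trans e e′ n = trans (e n) (e′ n)

  ≋-setoid : Setoid c ℓ
  ≋-setoid = record
    { Carrier = FPS ; _≈_ = _≋_
    ; isEquivalence = record { refl = ≋-refl ; sym = ≋-sym ; trans = ≋-trans } }

  scale : Carrier → FPS → FPS
  scale a f n = a * f n

  ⊛-cong : ∀ {f f′ g g′} → f ≋ f′ → g ≋ g′ → f ⊛ g ≋ f′ ⊛ g′
  ⊛-cong e e′ n = Σ-cong n (λ i → *-cong (e i) (e′ (n ∸ i)))

  ⊛-congˡ : ∀ {f f′} g → f ≋ f′ → f ⊛ g ≋ f′ ⊛ g
  ⊛-congˡ g e = ⊛-cong e (≋-refl {g})

  ⊛-congʳ : ∀ f {g g′} → g ≋ g′ → f ⊛ g ≋ f ⊛ g′
  ⊛-congʳ f e = ⊛-cong (≋-refl {f}) e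

  ⊛-comm : ∀ f g → f ⊛ g ≋ g ⊛ f
  ⊛-comm f g n = begin
    Σ≤ n (λ i → f i * g (n ∸ i))                ≈⟨ Σ-reverse n _ ⟩
    Σ≤ n (λ i → f (n ∸ i) * g (n ∸ (n ∸ i)))    ≈⟨ Σ-cong≤ n swap ⟩
    Σ≤ n (λ i → g i * f (n ∸ i))                ∎
    where
    swap : ∀ i → i ≤ n → f (n ∸ i) * g (n ∸ (n ∸ i)) ≈ g i * f (n ∸ i)
    swap i i≤n = trans (*-comm _ _) (*-cong (reflexive (P.cong g (ℕP.m∸[m∸n]≡n i≤n))) refl)

  ⊛-assoc : ∀ f g h → (f ⊛ g) ⊛ h ≋ f ⊛ (g ⊛ h)
  ⊛-assoc f g h n = begin
    Σ≤ n (λ i → Σ≤ i (λ j → f j * g (i ∸ j)) * h (n ∸ i))  ≈⟨ Σ-cong n (λ i → Σ-*ʳ i _ _) ⟩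
    Σ≤ n (λ i → Σ≤ i (λ j → f j * g (i ∸ j) * h (n ∸ i)))  ≈⟨ Σ-cong n (λ i → Σ-cong≤ i (λ j j≤i →
      *-cong refl (reflexive (P.cong (λ m → h (n ∸ m)) (P.sym (ℕP.m+[n∸m]≡n j≤i)))))) ⟩
    Σ≤ n (λ i → Σ≤ i (λ j → F j (i ∸ j)))                  ≈⟨ Σ-triangle n F ⟩
    Σ≤ n (λ j → Σ≤ (n ∸ j) (F j))                          ≈⟨ Σ-cong n (λ j → trans (Σ-cong (n ∸ j) (λ l →
      trans (*-assoc _ _ _) (*-cong refl (*-cong refl (reflexive (P.cong h (P.sym (ℕP.∸-+-assoc n j l))))))))
      (sym (Σ-*ˡ (n ∸ j) _ _))) ⟩
    Σ≤ n (λ j → f j * Σ≤ (n ∸ j) (λ l → g l * h ((n ∸ j) ∸ l))) ∎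
    where
    F : ℕ → ℕ → Carrier
    F j l = f j * g l * h (n ∸ (j ℕ.+ l))

  ⊛-identityˡ : ∀ f → oneS ⊛ f ≋ f
  ⊛-identityˡ f zero    = *-identityˡ _
  ⊛-identityˡ f (suc n) = begin
    Σ≤ (suc n) (λ i → oneS i * f (suc n ∸ i))      ≈⟨ Σ-unfoldˡ n _ ⟩
    1# * f (suc n) + Σ≤ n (λ i → 0# * f (n ∸ i))  ≈⟨ +-cong (*-identityˡ _) (Σ-zero n _ (λ i _ → zeroˡ _)) ⟩
    f (suc n) + 0#                                 ≈⟨ +-identityʳ _ ⟩
    f (suc n)                                      ∎

  ⊛-identityʳ : ∀ f → f ⊛ oneS ≋ f
  ⊛-identityʳ f = ≋-trans (⊛-comm f oneS) (⊛-identityˡ f)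

  ⊛-rearrange : ∀ f g h k → (f ⊛ g) ⊛ (h ⊛ k) ≋ (g ⊛ h) ⊛ (f ⊛ k)
  ⊛-rearrange f g h k =
    ≋-trans (⊛-assoc f g (h ⊛ k)) (≋-trans (⊛-congʳ f (≋-sym (⊛-assoc g h k)))
    (≋-trans (≋-sym (⊛-assoc f (g ⊛ h) k)) (≋-trans (⊛-congˡ k (⊛-comm f (g ⊛ h))) (⊛-assoc (g ⊛ h) f k))))

  scale-⊛ˡ : ∀ a f g → scale a f ⊛ g ≋ scale a (f ⊛ g)
  scale-⊛ˡ a f g n = trans (Σ-cong n (λ i → *-assoc _ _ _)) (sym (Σ-*ˡ n a _))

  scale-⊛ʳ : ∀ a f g → f ⊛ scale a g ≋ scale a (f ⊛ g)
  scale-⊛ʳ a f g n = trans (⊛-comm f (scale a g) n) (trans (scale-⊛ˡ a g f n) (*-cong refl (⊛-comm g f n)))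

  ⊛-distrib-⊖ : ∀ f g h → f ⊛ (g ⊖ h) ≋ (f ⊛ g) ⊖ (f ⊛ h)
  ⊛-distrib-⊖ f g h n = begin
    Σ≤ n (λ i → f i * (g (n ∸ i) - h (n ∸ i)))
      ≈⟨ Σ-cong n (λ i → trans (x[y-z]≈xy-xz _ _ _) (+-cong refl (-‿distribʳ-* _ _))) ⟩
    Σ≤ n (λ i → f i * g (n ∸ i) + f i * - h (n ∸ i))
      ≈⟨ Σ-+ n _ _ ⟩
    (f ⊛ g) n + Σ≤ n (λ i → f i * - h (n ∸ i))
      ≈⟨ +-cong refl (trans (Σ-cong n (λ i → sym (-‿distribʳ-* _ _))) (sym (Σ-neg n _))) ⟩
    (f ⊛ g) n - (f ⊛ h) n ∎

  divT-cong : ∀ {f g} → f ≋ g → divT f ≋ divT g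
  divT-cong e n = e (suc n)

  divT-⊛ : ∀ f g → g 0 ≈ 0# → divT (f ⊛ g) ≋ f ⊛ divT g
  divT-⊛ f g g0 n = begin
    Σ≤ n (λ i → f i * g (suc n ∸ i)) + f (suc n) * g (n ∸ n)
      ≈⟨ +-cong (Σ-cong≤ n (λ i i≤n → *-cong refl (reflexive (P.cong g (ℕP.+-∸-assoc 1 i≤n)))))
                (trans (*-cong refl (trans (reflexive (P.cong g (ℕP.n∸n≡0 n))) g0)) (zeroʳ _)) ⟩
    Σ≤ n (λ i → f i * g (suc (n ∸ i))) + 0# ≈⟨ +-identityʳ _ ⟩
    Σ≤ n (λ i → f i * g (suc (n ∸ i))) ∎

  -- The inverse invS of a series with constant term 1

  invUpTo-stable : ∀ a n i → i ≤ n → invUpTo a n i ≡ invS a i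
  invUpTo-stable a zero    .zero z≤n = P.refl
  invUpTo-stable a (suc m) i     i≤m+1 with ℕP.m≤n⇒m<n∨m≡n i≤m+1
  ... | inj₂ P.refl = P.refl
  ... | inj₁ (s≤s i≤m) with i ≤ᵇ m | ℕP.≤⇒≤ᵇ i≤m
  ...   | true | _ = invUpTo-stable a m i i≤m

  -- the test i ≤ᵇ n in invUpTo fails at i = n+1
  suc≰ᵇself : ∀ n → (suc n ≤ᵇ n) ≡ false
  suc≰ᵇself zero    = P.refl
  suc≰ᵇself (suc n) = suc≰ᵇself n

  invS-suc : ∀ a n → invS a (suc n) ≈ - Σ≤ n (λ j → a (suc j) * invS a (n ∸ j))
  invS-suc a n with suc n ≤ᵇ n | suc≰ᵇself n
  ... | false | _ = -‿cong (Σ-cong n (λ j →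
    *-cong refl (reflexive (invUpTo-stable a n (n ∸ j) (ℕP.m∸n≤m n j)))))

  invS-inverseʳ : ∀ a → a 0 ≈ 1# → a ⊛ invS a ≋ oneS
  invS-inverseʳ a a0 zero    = trans (*-identityʳ _) a0
  invS-inverseʳ a a0 (suc n) = begin
    Σ≤ (suc n) (λ i → a i * invS a (suc n ∸ i))  ≈⟨ Σ-unfoldˡ n _ ⟩
    a 0 * invS a (suc n) + S                     ≈⟨ +-cong (trans (*-cong a0 (invS-suc a n)) (*-identityˡ _)) refl ⟩
    - S + S                                      ≈⟨ -‿inverseˡ S ⟩
    0#                                           ∎
    where
    S = Σ≤ n (λ j → a (suc j) * invS a (n ∸ j))

  -- a right inverse is the inverse:  b = (a⁻¹a)b = a⁻¹(ab) = a⁻¹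
  invS-unique : ∀ a b → a 0 ≈ 1# → a ⊛ b ≋ oneS → b ≋ invS a
  invS-unique a b a0 ab =
    ≋-trans (≋-sym (⊛-identityˡ b))
    (≋-trans (⊛-congˡ b (≋-sym left-inverse))
    (≋-trans (⊛-assoc (invS a) a b)
    (≋-trans (⊛-congʳ (invS a) ab) (⊛-identityʳ (invS a)))))
    where
    left-inverse : invS a ⊛ a ≋ oneS
    left-inverse = ≋-trans (⊛-comm (invS a) a) (invS-inverseʳ a a0)

  ⊛-invS-cancel : ∀ f g → g 0 ≈ 1# → (f ⊛ g) ⊛ invS g ≋ f
  ⊛-invS-cancel f g g0 =
    ≋-trans (⊛-assoc f g (invS g)) (≋-trans (⊛-congʳ f (invS-inverseʳ g g0)) (⊛-identityʳ f))

  fromℕ : ℕ → Carrier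
  fromℕ n = n · 1#

  ι-nat : ∀ n → ι (nat n) ≈ fromℕ n
  ι-nat zero    = 0#-homo
  ι-nat (suc n) = begin
    ι (nat (suc n))        ≈⟨ reflexive (P.cong ι (P.sym (nat-+ 1 n))) ⟩
    ι (nat 1 ℚ.+ nat n)    ≈⟨ +-homo (nat 1) (nat n) ⟩
    ι (nat 1) + ι (nat n)  ≈⟨ +-cong 1#-homo (ι-nat n) ⟩
    1# + fromℕ n           ∎

  ι-product : ∀ {p q r} → p ℚ.* q ≡ r → ι p * ι q ≈ ι r
  ι-product {p} {q} eq = trans (sym (*-homo p q)) (reflexive (P.cong ι eq))

  fromℕ-*-1/! : ∀ n → fromℕ (suc n) * ι (1/! (suc n)) ≈ ι (1/! n)
  fromℕ-*-1/! n = trans (*-cong (sym (ι-nat (suc n))) refl) (ι-product (nat-*-1/! n))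

  1/suc-*-fromℕ : ∀ n → ι (1/suc n) * fromℕ (suc n) ≈ 1#
  1/suc-*-fromℕ n = trans (*-cong refl (sym (ι-nat (suc n)))) (trans (ι-product (1/suc-*-nat n)) 1#-homo)

  fromℕ-*-1/pow : ∀ j k → fromℕ (suc j) * ι (1/pow j (suc k)) ≈ ι (1/pow j k)
  fromℕ-*-1/pow j k = trans (*-cong (sym (ι-nat (suc j))) refl) (ι-product (nat-*-1/pow j k))

  -- multiplication by n+1 is injective, R being a ℚ-algebra
  fromℕ-suc-cancel : ∀ n {x y} → fromℕ (suc n) * x ≈ fromℕ (suc n) * y → x ≈ y
  fromℕ-suc-cancel n {x} {y} e = begin
    x                                        ≈⟨ *-identityˡ x ⟨
    1# * x                                   ≈⟨ *-cong (1/suc-*-fromℕ n) refl ⟨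
    (ι (1/suc n) * fromℕ (suc n)) * x        ≈⟨ *-assoc _ _ _ ⟩
    ι (1/suc n) * (fromℕ (suc n) * x)        ≈⟨ *-cong refl e ⟩
    ι (1/suc n) * (fromℕ (suc n) * y)        ≈⟨ *-assoc _ _ _ ⟨
    (ι (1/suc n) * fromℕ (suc n)) * y        ≈⟨ *-cong (1/suc-*-fromℕ n) refl ⟩
    1# * y                                   ≈⟨ *-identityˡ y ⟩
    y                                        ∎

  -- The formal derivative

  deriv : FPS → FPS
  deriv f n = fromℕ (suc n) * f (suc n)

  deriv-cong : ∀ {f g} → f ≋ g → deriv f ≋ deriv g
  deriv-cong e n = *-cong refl (e (suc n))

  -- Leibniz rule: (fg)' = f'g + fg', from (n+1) = i + (n+1-i) in each term
  leibniz : ∀ f g → deriv (f ⊛ g) ≋ (deriv f ⊛ g) ⊕ (f ⊛ deriv g)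
  leibniz f g n = begin
    fromℕ (suc n) * Σ≤ (suc n) T
      ≈⟨ Σ-*ˡ (suc n) _ T ⟩
    Σ≤ (suc n) (λ i → fromℕ (suc n) * T i)
      ≈⟨ Σ-cong≤ (suc n) split ⟩
    Σ≤ (suc n) (λ i → fromℕ i * T i + fromℕ (suc n ∸ i) * T i)
      ≈⟨ Σ-+ (suc n) _ _ ⟩
    Σ≤ (suc n) (λ i → fromℕ i * T i) + Σ≤ (suc n) (λ i → fromℕ (suc n ∸ i) * T i)
      ≈⟨ +-cong left right ⟩
    (deriv f ⊛ g) n + (f ⊛ deriv g) n ∎
    where
    T : ℕ → Carrier
    T i = f i * g (suc n ∸ i)
    split : ∀ i → i ≤ suc n → fromℕ (suc n) * T i ≈ fromℕ i * T i + fromℕ (suc n ∸ i) * T i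
    split i i≤n = trans (*-cong (trans (reflexive (P.cong fromℕ (P.sym (ℕP.m+[n∸m]≡n i≤n))))
                                       (×-homo-+ 1# i (suc n ∸ i))) refl) (distribʳ _ _ _)
    left : Σ≤ (suc n) (λ i → fromℕ i * T i) ≈ (deriv f ⊛ g) n
    left = begin
      Σ≤ (suc n) (λ i → fromℕ i * T i)                          ≈⟨ Σ-unfoldˡ n _ ⟩
      0# * T 0 + Σ≤ n (λ i → fromℕ (suc i) * T (suc i))         ≈⟨ +-cong (zeroˡ _) (Σ-cong n (λ i → sym (*-assoc _ _ _))) ⟩
      0# + (deriv f ⊛ g) n                                      ≈⟨ +-identityˡ _ ⟩
      (deriv f ⊛ g) n                                           ∎
    shift : ∀ i → suc n ∸ i ≡ suc (n ∸ i) → fromℕ (suc n ∸ i) * T i ≈ f i * deriv g (n ∸ i)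
    shift i eq rewrite eq = x∙yz≈y∙xz _ _ _
    right : Σ≤ (suc n) (λ i → fromℕ (suc n ∸ i) * T i) ≈ (f ⊛ deriv g) n
    right = begin
      Σ≤ n (λ i → fromℕ (suc n ∸ i) * T i) + fromℕ (n ∸ n) * T (suc n)
        ≈⟨ +-cong (Σ-cong≤ n (λ i i≤n → shift i (ℕP.+-∸-assoc 1 i≤n)))
                  (trans (*-cong (reflexive (P.cong fromℕ (ℕP.n∸n≡0 n))) refl) (zeroˡ _)) ⟩
      (f ⊛ deriv g) n + 0# ≈⟨ +-identityʳ _ ⟩
      (f ⊛ deriv g) n ∎

  deriv-pow : ∀ f m → deriv (f ^S suc m) ≋ scale (fromℕ (suc m)) ((f ^S m) ⊛ deriv f)
  deriv-pow f zero n = begin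
    deriv (f ⊛ oneS) n                  ≈⟨ deriv-cong (⊛-identityʳ f) n ⟩
    deriv f n                           ≈⟨ ⊛-identityˡ (deriv f) n ⟨
    (oneS ⊛ deriv f) n                  ≈⟨ *-identityˡ _ ⟨
    1# * (oneS ⊛ deriv f) n             ≈⟨ *-cong (+-identityʳ 1#) refl ⟨
    (1# + 0#) * (oneS ⊛ deriv f) n      ∎
  deriv-pow f (suc m) n = begin
    deriv (f ⊛ P) n                                   ≈⟨ leibniz f P n ⟩
    (deriv f ⊛ P) n + (f ⊛ deriv P) n                 ≈⟨ +-cong (⊛-comm (deriv f) P n) (⊛-congʳ f (deriv-pow f m) n) ⟩
    X n + (f ⊛ scale c₁ ((f ^S m) ⊛ deriv f)) n         ≈⟨ +-cong refl (scale-⊛ʳ c₁ f ((f ^S m) ⊛ deriv f) n) ⟩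
    X n + c₁ * (f ⊛ ((f ^S m) ⊛ deriv f)) n             ≈⟨ +-cong refl (*-cong refl (⊛-assoc f (f ^S m) (deriv f) n)) ⟨
    X n + c₁ * X n                                    ≈⟨ +-cong (*-identityˡ _) refl ⟨
    1# * X n + c₁ * X n                               ≈⟨ distribʳ _ _ _ ⟨
    (1# + c₁) * X n                                   ∎
    where
    P = f ^S suc m
    c₁ = fromℕ (suc m)
    X = P ⊛ deriv f

  -- Exponential series e^{at}

  pow-cong : ∀ {a b} n → a ≈ b → pow a n ≈ pow b n
  pow-cong zero    e = refl
  pow-cong (suc n) e = *-cong e (pow-cong n e)

  expS-cong : ∀ {a b} → a ≈ b → expS a ≋ expS b
  expS-cong e n = *-cong (pow-cong n e) refl

  expS-const : ∀ a → expS a 0 ≈ 1#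
  expS-const a = trans (*-identityˡ _) 1#-homo

  deriv-expS : ∀ a → deriv (expS a) ≋ scale a (expS a)
  deriv-expS a n = begin
    fromℕ (suc n) * ((a * pow a n) * ι (1/! (suc n)))
      ≈⟨ solve 4 (λ x y z w → x :* ((y :* z) :* w) := y :* (z :* (x :* w))) refl _ _ _ _ ⟩
    a * (pow a n * (fromℕ (suc n) * ι (1/! (suc n))))  ≈⟨ *-cong refl (*-cong refl (fromℕ-*-1/! n)) ⟩
    a * (pow a n * ι (1/! n))                          ∎

  expS-unique : ∀ F a → F 0 ≈ 1# → deriv F ≋ scale a F → F ≋ expS a
  expS-unique F a F0 dF zero    = trans F0 (sym (expS-const a))
  expS-unique F a F0 dF (suc n) = fromℕ-suc-cancel n (begin
    fromℕ (suc n) * F (suc n)          ≈⟨ dF n ⟩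
    a * F n                            ≈⟨ *-cong refl (expS-unique F a F0 dF n) ⟩
    a * expS a n                       ≈⟨ deriv-expS a n ⟨
    fromℕ (suc n) * expS a (suc n)     ∎)

  expS-+ : ∀ a b → expS a ⊛ expS b ≋ expS (a + b)
  expS-+ a b = expS-unique (expS a ⊛ expS b) (a + b) const-term derivative
    where
    const-term : (expS a ⊛ expS b) 0 ≈ 1#
    const-term = trans (*-cong (expS-const a) (expS-const b)) (*-identityˡ _)
    derivative : deriv (expS a ⊛ expS b) ≋ scale (a + b) (expS a ⊛ expS b)
    derivative n = begin
      deriv (expS a ⊛ expS b) n                                     ≈⟨ leibniz (expS a) (expS b) n ⟩
      (deriv (expS a) ⊛ expS b) n + (expS a ⊛ deriv (expS b)) n
        ≈⟨ +-cong (trans (⊛-congˡ (expS b) (deriv-expS a) n) (scale-⊛ˡ a (expS a) (expS b) n))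
                  (trans (⊛-congʳ (expS a) (deriv-expS b) n) (scale-⊛ʳ b (expS a) (expS b) n)) ⟩
      a * (expS a ⊛ expS b) n + b * (expS a ⊛ expS b) n             ≈⟨ distribʳ _ _ _ ⟨
      (a + b) * (expS a ⊛ expS b) n                                 ∎

  expS-0# : expS 0# ≋ oneS
  expS-0# zero    = expS-const 0#
  expS-0# (suc n) = trans (*-cong (zeroˡ _) refl) (zeroˡ _)

  ^S-order : ∀ f → f 0 ≈ 0# → ∀ m n → n < m → (f ^S m) n ≈ 0#
  ^S-order f f0 (suc m) n (s≤s n≤m) = Σ-zero n _ term
    where
    term : ∀ i → i ≤ n → f i * (f ^S m) (n ∸ i) ≈ 0#
    term zero    _   = trans (*-cong f0 refl) (zeroˡ _)
    term (suc i) i<n = trans (*-cong refl (^S-order f f0 m (n ∸ suc i) (ℕP.<-≤-trans (below i<n) n≤m))) (zeroʳ _)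
      where
      below : ∀ {n i} → suc i ≤ n → n ∸ suc i < n
      below {suc n} {i} _ = s≤s (ℕP.m∸n≤m n i)

  -- Infinite sums Σ_j G_j of families where G_j has order ≥ j
  -- (the coefficient of tⁿ only involves j ≤ n)

  Σ∞ : (ℕ → FPS) → FPS
  Σ∞ G n = Σ≤ n (λ j → G j n)

  Σ∞-cong : ∀ {G G′ : ℕ → FPS} → (∀ j → G j ≋ G′ j) → Σ∞ G ≋ Σ∞ G′
  Σ∞-cong e n = Σ-cong n (λ j → e j n)

  Σ∞-⊛ : ∀ (G : ℕ → FPS) h → (∀ j i → i < j → G j i ≈ 0#) → Σ∞ G ⊛ h ≋ Σ∞ (λ j → G j ⊛ h)
  Σ∞-⊛ G h z n = begin
    Σ≤ n (λ i → Σ≤ i (λ j → G j i) * h (n ∸ i))      ≈⟨ Σ-cong n (λ i → Σ-*ʳ i _ _) ⟩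
    Σ≤ n (λ i → Σ≤ i (λ j → G j i * h (n ∸ i)))      ≈⟨ Σ-cong n (λ i → Σ-cong≤ i (λ j j≤i →
      reflexive (P.cong (λ m → G j m * h (n ∸ m)) (P.sym (ℕP.m+[n∸m]≡n j≤i))))) ⟩
    Σ≤ n (λ i → Σ≤ i (λ j → F j (i ∸ j)))            ≈⟨ Σ-triangle n F ⟩
    Σ≤ n (λ j → Σ≤ (n ∸ j) (F j))                    ≈⟨ Σ-cong≤ n (λ j j≤n →
      sym (Σ-dropZeros j n (λ i → G j i * h (n ∸ i)) j≤n (λ i i<j → trans (*-cong (z j i i<j) refl) (zeroˡ _)))) ⟩
    Σ≤ n (λ j → (G j ⊛ h) n)                         ∎
    where
    F : ℕ → ℕ → Carrier
    F j l = G j (j ℕ.+ l) * h (n ∸ (j ℕ.+ l))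

  Σ∞-deriv : ∀ (G : ℕ → FPS) → (∀ j i → i ≤ j → G j i ≈ 0#) → deriv (Σ∞ G) ≋ Σ∞ (λ j → deriv (G j))
  Σ∞-deriv G z n = begin
    fromℕ (suc n) * (Σ≤ n (λ j → G j (suc n)) + G (suc n) (suc n))  ≈⟨ *-cong refl (+-cong refl (z (suc n) (suc n) ℕP.≤-refl)) ⟩
    fromℕ (suc n) * (Σ≤ n (λ j → G j (suc n)) + 0#)                 ≈⟨ *-cong refl (+-identityʳ _) ⟩
    fromℕ (suc n) * Σ≤ n (λ j → G j (suc n))                        ≈⟨ Σ-*ˡ n _ _ ⟩
    Σ≤ n (λ j → fromℕ (suc n) * G j (suc n))                        ∎

  -- The polylogarithm: Li_k(f) = Σ_j f^{j+1}/(j+1)^k is, by definition, a Σ∞,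
  -- and Li_k(f)/f is the series  LiOver k f = Σ_j f^j/(j+1)^k.

  Li-coeff : ℕ → ℕ → Carrier
  Li-coeff k j = ι (1/pow j k)

  LiOver : ℕ → FPS → FPS
  LiOver k f = Σ∞ (λ j → scale (Li-coeff k j) (f ^S j))

  scaled-order : ∀ f → f 0 ≈ 0# → ∀ a m i → i < m → scale a (f ^S m) i ≈ 0#
  scaled-order f f0 a m i i<m = trans (*-cong refl (^S-order f f0 m i i<m)) (zeroʳ _)

  LiOver-⊛ : ∀ k f → f 0 ≈ 0# → LiOver k f ⊛ f ≋ Li k f
  LiOver-⊛ k f f0 = ≋-trans (Σ∞-⊛ _ f (λ j → scaled-order f f0 _ j))
    (Σ∞-cong (λ j → ≋-trans (scale-⊛ˡ _ (f ^S j) f) (λ n → *-cong refl (⊛-comm (f ^S j) f n))))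

  Li-deriv : ∀ k f → f 0 ≈ 0# → deriv (Li (suc k) f) ≋ LiOver k f ⊛ deriv f
  Li-deriv k f f0 =
    ≋-trans (Σ∞-deriv (λ j → scale (Li-coeff (suc k) j) (f ^S suc j))
                      (λ j i i≤j → scaled-order f f0 _ (suc j) i (s≤s i≤j)))
    (≋-trans (Σ∞-cong term)
             (≋-sym (Σ∞-⊛ (λ j → scale (Li-coeff k j) (f ^S j)) (deriv f) (λ j → scaled-order f f0 _ j))))
    where
    term : ∀ j → deriv (scale (Li-coeff (suc k) j) (f ^S suc j)) ≋ scale (Li-coeff k j) (f ^S j) ⊛ deriv f
    term j n = begin
      fromℕ (suc n) * (c₊ * (f ^S suc j) (suc n))   ≈⟨ x∙yz≈y∙xz _ _ _ ⟩
      c₊ * deriv (f ^S suc j) n                     ≈⟨ *-cong refl (deriv-pow f j n) ⟩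
      c₊ * (fromℕ (suc j) * X n)                    ≈⟨ *-assoc _ _ _ ⟨
      (c₊ * fromℕ (suc j)) * X n                    ≈⟨ *-cong (trans (*-comm _ _) (fromℕ-*-1/pow j k)) refl ⟩
      Li-coeff k j * X n                            ≈⟨ scale-⊛ˡ _ (f ^S j) (deriv f) n ⟨
      (scale (Li-coeff k j) (f ^S j) ⊛ deriv f) n   ∎
      where
      c₊ = Li-coeff (suc k) j
      X = (f ^S j) ⊛ deriv f

  binomial-factorials : ∀ n l → l ≤ n → (suc n C suc l) ℕ.* ((suc l) ! ℕ.* (n ∸ l) !) ≡ (suc n) !
  binomial-factorials n l l≤n =
    P.trans (P.cong (ℕ._* ((suc l) ! ℕ.* (n ∸ l) !)) (nCk≡n!/k![n-k]! (s≤s l≤n)))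
            (m/n*n≡m {{(suc l) ℕP.!* (n ∸ l) !≢0}} (k![n∸k]!∣n! (s≤s l≤n)))

  binomial-weight : ∀ n l → l ≤ n →
    ι (1/suc n) * (fromℕ (suc n C suc l) * ((fromℕ (suc l) * fromℕ (l !)) * fromℕ ((n ∸ l) !))) ≈ ι (nat (n !))
  binomial-weight n l l≤n = begin
    ι (1/suc n) * (fromℕ Cnl * ((fromℕ (suc l) * fromℕ (l !)) * fromℕ ((n ∸ l) !)))
      ≈⟨ *-cong refl (*-cong refl (trans (×1-homo-* ((suc l) !) _) (*-cong (×1-homo-* (suc l) (l !)) refl))) ⟨
    ι (1/suc n) * (fromℕ Cnl * fromℕ ((suc l) ! ℕ.* (n ∸ l) !))  ≈⟨ *-cong refl (×1-homo-* Cnl _) ⟨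
    ι (1/suc n) * fromℕ (Cnl ℕ.* ((suc l) ! ℕ.* (n ∸ l) !))      ≈⟨ *-cong refl (reflexive (P.cong fromℕ (binomial-factorials n l l≤n))) ⟩
    ι (1/suc n) * fromℕ (suc n ℕ.* n !)                          ≈⟨ *-cong refl (×1-homo-* (suc n) (n !)) ⟩
    ι (1/suc n) * (fromℕ (suc n) * fromℕ (n !))                  ≈⟨ *-assoc _ _ _ ⟨
    (ι (1/suc n) * fromℕ (suc n)) * fromℕ (n !)                  ≈⟨ *-cong (1/suc-*-fromℕ n) refl ⟩
    1# * fromℕ (n !)                                             ≈⟨ *-identityˡ _ ⟩
    fromℕ (n !)                                                  ≈⟨ ι-nat (n !) ⟨
    ι (nat (n !))                                                ∎
    where Cnl = suc n C suc l

  coefficient-extraction : ∀ (F B Y : FPS) n → Y ≋ deriv F →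
    ι (nat (n !)) * (divT F ⊛ B) n
      ≈ ι (1/suc n) * Σ≤ n (λ l → ι (nat (suc n C suc l)) * (ι (nat ((n ∸ l) !)) * B (n ∸ l)) * (ι (nat (l !)) * Y l))
  coefficient-extraction F B Y n Y≋F′ = sym (begin
    ι (1/suc n) * Σ≤ n T                                ≈⟨ Σ-*ˡ n _ T ⟩
    Σ≤ n (λ l → ι (1/suc n) * T l)                      ≈⟨ Σ-cong≤ n term ⟩
    Σ≤ n (λ l → ι (nat (n !)) * (F (suc l) * B (n ∸ l))) ≈⟨ Σ-*ˡ n _ _ ⟨
    ι (nat (n !)) * (divT F ⊛ B) n                      ∎)
    where
    T : ℕ → Carrier
    T l = ι (nat (suc n C suc l)) * (ι (nat ((n ∸ l) !)) * B (n ∸ l)) * (ι (nat (l !)) * Y l)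
    term : ∀ l → l ≤ n → ι (1/suc n) * T l ≈ ι (nat (n !)) * (F (suc l) * B (n ∸ l))
    term l l≤n = begin
      ι (1/suc n) * T l
        ≈⟨ *-cong refl (*-cong (*-cong (ι-nat Cnl) (*-cong (ι-nat a) refl)) (*-cong (ι-nat b) (Y≋F′ l))) ⟩
      ι (1/suc n) * (fromℕ Cnl * (fromℕ a * B (n ∸ l)) * (fromℕ b * (fromℕ (suc l) * F (suc l))))
        ≈⟨ solve 7 (λ w c fa x fb s y → w :* (c :* (fa :* x) :* (fb :* (s :* y)))
                                       := (w :* (c :* ((s :* fb) :* fa))) :* (y :* x)) refl _ _ _ _ _ _ _ ⟩
      (ι (1/suc n) * (fromℕ Cnl * ((fromℕ (suc l) * fromℕ b) * fromℕ a))) * (F (suc l) * B (n ∸ l))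
        ≈⟨ *-cong (binomial-weight n l l≤n) refl ⟩
      ι (nat (n !)) * (F (suc l) * B (n ∸ l)) ∎
      where
      Cnl = suc n C suc l
      a = (n ∸ l) !
      b = l !

module GeneratingFunctions {c ℓ : Level} (R : CommutativeRing c ℓ) (ι : ℚ → CommutativeRing.Carrier R)
  (hom : IsRingHomomorphism (CommutativeRing.rawRing +-*-commutativeRing) (CommutativeRing.rawRing R) ι) where

  open CommutativeRing R hiding (zero)
  open Series R ι
  open PowerSeries R ι hom
  open IsRingHomomorphism hom using (1#-homo)
  open import Algebra.Properties.Ring ring using (-1*x≈-x; -‿distribʳ-*; -‿involutive; -0#≈0#)
  module ≈-Reasoning = Relation.Binary.Reasoning.Setoid setoid
  module ≋-Reasoning = Relation.Binary.Reasoning.Setoid ≋-setoid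

  e⁺ e⁻ U E : FPS
  e⁺ = expS 1#
  e⁻ = expS (- 1#)
  U  = divT u
  E  = divT eMinus1

  u-const : u 0 ≈ 0#
  u-const = trans (+-cong refl (-‿cong (expS-const (- 1#)))) (-‿inverseʳ 1#)

  U-const : U 0 ≈ 1#
  U-const = begin
    0# - (- 1# * 1#) * ι (1/! 1)   ≈⟨ +-identityˡ _ ⟩
    - ((- 1# * 1#) * ι (1/! 1))     ≈⟨ -‿cong (*-cong (*-identityʳ _) 1#-homo) ⟩
    - (- 1# * 1#)                   ≈⟨ -‿cong (*-identityʳ _) ⟩
    - (- 1#)                        ≈⟨ -‿involutive _ ⟩
    1#                              ∎
    where open ≈-Reasoning

  E-const : E 0 ≈ 1#
  E-const = begin
    (1# * 1#) * ι (1/! 1) - 0#   ≈⟨ +-cong (*-cong (*-identityʳ _) 1#-homo) -0#≈0# ⟩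
    1# * 1# + 0#                 ≈⟨ +-identityʳ _ ⟩
    1# * 1#                      ≈⟨ *-identityʳ _ ⟩
    1#                           ∎
    where open ≈-Reasoning

  deriv-u : deriv u ≋ e⁻
  deriv-u n = begin
    fromℕ (suc n) * (0# - e⁻ (suc n))   ≈⟨ *-cong refl (+-identityˡ _) ⟩
    fromℕ (suc n) * (- e⁻ (suc n))      ≈⟨ -‿distribʳ-* _ _ ⟨
    - (fromℕ (suc n) * e⁻ (suc n))      ≈⟨ -‿cong (deriv-expS (- 1#) n) ⟩
    - (- 1# * e⁻ n)                     ≈⟨ -‿cong (-1*x≈-x _) ⟩
    - (- e⁻ n)                          ≈⟨ -‿involutive _ ⟩
    e⁻ n                                ∎
    where open ≈-Reasoning

  e⁺-e⁻ : e⁺ ⊛ e⁻ ≋ oneS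
  e⁺-e⁻ = ≋-trans (expS-+ 1# (- 1#)) (≋-trans (expS-cong (-‿inverseʳ 1#)) expS-0#)

  E≋e⁺U : E ≋ e⁺ ⊛ U
  E≋e⁺U = ≋-trans (divT-cong (≋-sym e⁺u)) (divT-⊛ e⁺ u u-const)
    where
    e⁺u : e⁺ ⊛ u ≋ eMinus1
    e⁺u n = trans (⊛-distrib-⊖ e⁺ oneS e⁻ n) (+-cong (⊛-identityʳ e⁺ n) (-‿cong (e⁺-e⁻ n)))

  invE : invS E ≋ invS U ⊛ e⁻
  invE = ≋-sym (invS-unique E (invS U ⊛ e⁻) E-const (begin
    E ⊛ (invS U ⊛ e⁻)          ≈⟨ ⊛-congˡ (invS U ⊛ e⁻) E≋e⁺U ⟩
    (e⁺ ⊛ U) ⊛ (invS U ⊛ e⁻)   ≈⟨ ⊛-rearrange e⁺ U (invS U) e⁻ ⟩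
    (U ⊛ invS U) ⊛ (e⁺ ⊛ e⁻)   ≈⟨ ⊛-cong (invS-inverseʳ U U-const) e⁺-e⁻ ⟩
    oneS ⊛ oneS                ≈⟨ ⊛-identityˡ oneS ⟩
    oneS                       ∎))
    where open ≋-Reasoning

  Bgen-shift : ∀ z → Bgen (z + 1#) ≋ invS U ⊛ expS z
  Bgen-shift z = begin
    invS E ⊛ expS (z + 1#)              ≈⟨ ⊛-congˡ (expS (z + 1#)) invE ⟩
    (invS U ⊛ e⁻) ⊛ expS (z + 1#)       ≈⟨ ⊛-assoc (invS U) e⁻ (expS (z + 1#)) ⟩
    invS U ⊛ (e⁻ ⊛ expS (z + 1#))       ≈⟨ ⊛-congʳ (invS U) (expS-+ (- 1#) (z + 1#)) ⟩
    invS U ⊛ expS (- 1# + (z + 1#))     ≈⟨ ⊛-congʳ (invS U) (expS-cong -1+[z+1]≈z) ⟩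
    invS U ⊛ expS z                     ∎
    where
    open ≋-Reasoning
    -1+[z+1]≈z : - 1# + (z + 1#) ≈ z
    -1+[z+1]≈z = trans (+-comm _ _) (trans (+-assoc _ _ _) (trans (+-cong refl (-‿inverseʳ 1#)) (+-identityʳ z)))

  Li-over-t : ∀ k → divT (Li k u) ≋ LiOver k u ⊛ U
  Li-over-t k = ≋-trans (divT-cong (≋-sym (LiOver-⊛ k u u-const))) (divT-⊛ (LiOver k u) u u-const)

  deriv-Li-u : ∀ k → deriv (Li (suc k) u) ≋ LiOver k u ⊛ e⁻
  deriv-Li-u k = ≋-trans (Li-deriv k u u-const) (⊛-congʳ (LiOver k u) deriv-u)

  PBgen-factor : ∀ k z → PBgen k z ≋ divT (Li k u) ⊛ Bgen (z + 1#)
  PBgen-factor k z = ≋-trans (⊛-assoc (divT (Li k u)) (invS U) (expS z))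
                             (⊛-congʳ (divT (Li k u)) (≋-sym (Bgen-shift z)))

  Cgen-factor : ∀ k z → Cgen k z ≋ divT (Li k u) ⊛ Bgen z
  Cgen-factor k z = ⊛-assoc (divT (Li k u)) (invS E) (expS z)

  PBgen-at-−1 : ∀ k → PBgen k (- 1#) ≋ deriv (Li (suc k) u)
  PBgen-at-−1 k = begin
    (divT (Li k u) ⊛ invS U) ⊛ e⁻     ≈⟨ ⊛-congˡ e⁻ (⊛-congˡ (invS U) (Li-over-t k)) ⟩
    ((Q ⊛ U) ⊛ invS U) ⊛ e⁻           ≈⟨ ⊛-congˡ e⁻ (⊛-invS-cancel Q U U-const) ⟩
    Q ⊛ e⁻                            ≈⟨ deriv-Li-u k ⟨
    deriv (Li (suc k) u)              ∎
    where
    open ≋-Reasoning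
    Q = LiOver k u

  Cgen-at-0 : ∀ k → Cgen k 0# ≋ deriv (Li (suc k) u)
  Cgen-at-0 k = begin
    (divT (Li k u) ⊛ invS E) ⊛ expS 0#   ≈⟨ ⊛-congʳ (divT (Li k u) ⊛ invS E) expS-0# ⟩
    (divT (Li k u) ⊛ invS E) ⊛ oneS      ≈⟨ ⊛-identityʳ (divT (Li k u) ⊛ invS E) ⟩
    divT (Li k u) ⊛ invS E               ≈⟨ ⊛-cong (Li-over-t k) invE ⟩
    (Q ⊛ U) ⊛ (invS U ⊛ e⁻)              ≈⟨ ⊛-assoc (Q ⊛ U) (invS U) e⁻ ⟨
    ((Q ⊛ U) ⊛ invS U) ⊛ e⁻              ≈⟨ ⊛-congˡ e⁻ (⊛-invS-cancel Q U U-const) ⟩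
    Q ⊛ e⁻                               ≈⟨ deriv-Li-u k ⟨
    deriv (Li (suc k) u)                 ∎
    where
    open ≋-Reasoning
    Q = LiOver k u

  polyBernoulli-recurrence : ∀ k n z →
    PB (suc k) n z ≈ ι (1/suc n) * Σ≤ n (λ l → ι (nat (suc n C suc l)) * Bpoly (n ∸ l) (z + 1#) * PB k l (- 1#))
  polyBernoulli-recurrence k n z =
    trans (*-cong refl (PBgen-factor (suc k) z n))
          (coefficient-extraction (Li (suc k) u) (Bgen (z + 1#)) (PBgen k (- 1#)) n (PBgen-at-−1 k))

  companion-recurrence : ∀ k n z →
    Cpoly (suc k) n z ≈ ι (1/suc n) * Σ≤ n (λ l → ι (nat (suc n C suc l)) * Bpoly (n ∸ l) z * Cnum k l)
  companion-recurrence k n z =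
    trans (*-cong refl (Cgen-factor (suc k) z n))
          (coefficient-extraction (Li (suc k) u) (Bgen z) (Cgen k 0#) n (Cgen-at-0 k))

theorem7 : {c ℓ : Level} (R : CommutativeRing c ℓ) (ι : ℚ → CommutativeRing.Carrier R) →
  IsRingHomomorphism (CommutativeRing.rawRing +-*-commutativeRing) (CommutativeRing.rawRing R) ι →
  let open CommutativeRing R
      open Series R ι
  in (k n : ℕ) → 2 ≤ k → (z : Carrier) →
    (PB k n z ≈ ι (1/suc n) * Σ≤ n (λ l → ι (nat (suc n C suc l)) * Bpoly (n ∸ l) (z + 1#) * PB (k ∸ 1) l (- 1#)))
    × (Cpoly k n z ≈ ι (1/suc n) * Σ≤ n (λ l → ι (nat (suc n C suc l)) * Bpoly (n ∸ l) z * Cnum (k ∸ 1) l))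
theorem7 R ι hom (suc (suc k)) n (s≤s (s≤s z≤n)) z =
  polyBernoulli-recurrence (suc k) n z , companion-recurrence (suc k) n z
  where open GeneratingFunctions R ι hom
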